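{- A nonempty subset $L$ of $G$ is convex if and only if (i) whenever $x\le y\le z$ and $x,z\in L$ then $y\in L$, and (ii) whenever $x,y\in L$ then $x\wedge y\in L$ and, if $x\vee y$ is finite, $x\vee y\in L$.
   Context: Let $F$ be a set of unordered pairs of distinct elements of $[k]$, and $G=G_F$ the group generated by $g_1,\dots,g_k$ subject to $g_ig_j=g_jg_i$ for distinct $i,j$ with $\{i,j\}\notin F$. $|x|$ is the minimum length of a word in $g_1^{\pm1},\dots,g_k^{\pm1}$ representing $x$. $x\le y$ iff $|y|=|x|+|x^{ -1}y|$ (a partial order); $x\wedge y$ is the greatest lower bound (always exists) and $x\vee y$ the least upper bound if $x,y$ have a common upper bound (otherwise $x\vee y=\infty$, "infinite"). $\mathrm{dist}(x,y)=|x^{ -1}y|$. A subset $L\subseteq G$ is convex if it is nonempty and whenever $x,z\in L$, $y\in G$ and $\mathrm{dist}(x,y)+\mathrm{dist}(y,z)=\mathrm{dist}(x,z)$, then $y\in L$. -}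

module Defs where

open import Data.Nat using (ℕ; _+_; _≤_)
open import Data.Fin using (Fin)
open import Data.Bool using (Bool; true; false; not)
open import Data.List using (List; []; _∷_; _++_; length; reverse; map)
open import Data.Product using (_×_; _,_; ∃; ∃-syntax; Σ)
open import Relation.Binary.PropositionalEquality using (_≡_; _≢_)

-- A letter g_i^{+1} is (i , true), g_i^{-1} is (i , false).
Letter : ℕ → Set
Letter k = Fin k × Bool

-- A word in g_1^{±1},…,g_k^{±1}; elements of G_F are words up to _≈_ below.
Word : ℕ → Set
Word k = List (Letter k)

invLetter : ∀ {k} → Letter k → Letter k
invLetter (i , b) = (i , not b)

inv : ∀ {k} → Word k → Word k
inv w = reverse (map invLetter w)

-- F is a set of unordered pairs of distinct elements of [k] = Fin k:
-- the pair {i,j} (i ≢ j) belongs to F iff  F i j ≡ true  or  F j i ≡ true.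
PairSet : ℕ → Set
PairSet k = Fin k → Fin k → Bool

-- g_i and g_j are required to commute: i ≢ j and {i,j} ∉ F.
Commuting : ∀ {k} → PairSet k → Fin k → Fin k → Set
Commuting F i j = (i ≢ j) × (F i j ≡ false) × (F j i ≡ false)

-- Equality in G_F: the congruence on words generated by free cancellation
-- and the defining commutation relations (with either signs, which is
-- a consequence of g_i g_j = g_j g_i).
data _≈[_]_ {k : ℕ} : Word k → PairSet k → Word k → Set where
  ≈-refl  : ∀ {F w} → w ≈[ F ] w
  ≈-sym   : ∀ {F u v} → u ≈[ F ] v → v ≈[ F ] u
  ≈-trans : ∀ {F u v w} → u ≈[ F ] v → v ≈[ F ] w → u ≈[ F ] w
  ≈-cancel : ∀ {F} (u v : Word k) (a : Letter k) →
             (u ++ a ∷ invLetter a ∷ v) ≈[ F ] (u ++ v)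
  ≈-comm  : ∀ {F} (u v : Word k) (i j : Fin k) (b c : Bool) →
             Commuting F i j →
             (u ++ (i , b) ∷ (j , c) ∷ v) ≈[ F ] (u ++ (j , c) ∷ (i , b) ∷ v)

Norm : ∀ {k} → PairSet k → Word k → ℕ → Set
Norm F x n = (∃[ w ] (w ≈[ F ] x × length w ≡ n))
           × (∀ w → w ≈[ F ] x → n ≤ length w)

Dist : ∀ {k} → PairSet k → Word k → Word k → ℕ → Set
Dist F x y n = Norm F (inv x ++ y) n

Below : ∀ {k} → PairSet k → Word k → Word k → Set
Below F x y = ∃[ a ] ∃[ b ] ∃[ c ]
  (Norm F x a × Norm F y b × Dist F x y c × b ≡ a + c)

IsMeet : ∀ {k} → PairSet k → Word k → Word k → Word k → Set
IsMeet F m x y = Below F m x × Below F m y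
  × (∀ z → Below F z x → Below F z y → Below F z m)

-- j is a least upper bound of x and y (exists iff x ∨ y is finite)
IsJoin : ∀ {k} → PairSet k → Word k → Word k → Word k → Set
IsJoin F j x y = Below F x j × Below F y j
  × (∀ z → Below F x z → Below F y z → Below F j z)

-- A subset of G_F: a predicate on words closed under _≈_.
IsSubset : ∀ {k} → PairSet k → (Word k → Set) → Set
IsSubset F L = ∀ u v → u ≈[ F ] v → L u → L v

Nonempty : ∀ {k} → (Word k → Set) → Set
Nonempty L = ∃[ x ] L x

Convex : ∀ {k} → PairSet k → (Word k → Set) → Set
Convex F L = Nonempty L ×
  (∀ x y z (a b c : ℕ) → L x → L z →
     Dist F x y a → Dist F y z b → Dist F x z c → a + b ≡ c → L y)

IntervalClosed : ∀ {k} → PairSet k → (Word k → Set) → Set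
IntervalClosed F L = ∀ x y z → Below F x y → Below F y z → L x → L z → L y

LatticeClosed : ∀ {k} → PairSet k → (Word k → Set) → Set
LatticeClosed F L = ∀ x y → L x → L y →
  (∀ m → IsMeet F m x y → L m) × (∀ j → IsJoin F j x y → L j)

-- Pushing letters one at a time onto a word, cancelling each against the first
-- dependent letter if that is its inverse, computes reduced words and hence |x|.
-- With it, G_F is a median space: 1, x, y have a unique median x ∧ y, obtained by
-- cancelling common left descents.  Meets, joins and order intervals lie between
-- their endpoints, so convex sets satisfy (i) and (ii).  Conversely a geodesic from
-- x to z is walked one letter at a time: a step down from x stays above x ∧ z, and
-- a step up x·a is the join of x with (x·a) ∧ z, so (i) and (ii) keep every step in L.
module Submission where

open import Defs
open import Data.Nat using (ℕ; zero; suc; _+_; _≤_; z≤n; s≤s)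
open import Data.Nat.Properties
open import Data.Nat.Solver using (module +-*-Solver)
import Data.Fin.Properties as Fin
open import Data.Bool using (Bool; true; false; not; _∨_)
import Data.Bool.Properties as Bool
open import Data.List using ([]; _∷_; _++_; [_]; length; reverse; map)
open import Data.List.Properties
  using (++-assoc; ++-identityʳ; map-++; length-++; length-++-sucʳ; length-map; length-reverse;
         reverse-++; reverse-map; reverse-involutive)
open import Data.List.Relation.Unary.All using (All; []; _∷_)
open import Data.Maybe using (Maybe; just; nothing; fromMaybe)
import Data.Maybe as Maybe
open import Data.Maybe.Properties using () renaming (map-just to Maybe-map-just)
open import Data.Maybe.Relation.Binary.Pointwise using (Pointwise; just; nothing)
open import Data.Product using (∃-syntax; _×_; _,_; proj₁; proj₂)
open import Data.Product.Properties using (≡-dec)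
open import Data.Sum using (_⊎_; inj₁; inj₂)
open import Data.Empty using (⊥-elim)
open import Function using (_∘_)
open import Relation.Nullary using (Dec; yes; no; ¬_; contradiction)
open import Relation.Nullary.Decidable using (⌊_⌋; _×-dec_; _⊎-dec_)
open import Relation.Binary.Bundles using (Setoid)
import Relation.Binary.Reasoning.Setoid as SetoidReasoning
open import Relation.Binary.PropositionalEquality using (_≡_; refl; sym; trans; cong; cong₂; subst; module ≡-Reasoning)

invLetter-involutive : ∀ {k} (a : Letter k) → invLetter (invLetter a) ≡ a
invLetter-involutive (i , true)  = refl
invLetter-involutive (i , false) = refl

invLetter-injective : ∀ {k} {a b : Letter k} → invLetter a ≡ invLetter b → a ≡ b
invLetter-injective {a = a} {b} eq =
  trans (sym (invLetter-involutive a)) (trans (cong invLetter eq) (invLetter-involutive b))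

module _ {k : ℕ} where
  open ≡-Reasoning

  inv-++ : (u v : Word k) → inv (u ++ v) ≡ inv v ++ inv u
  inv-++ u v = begin
    reverse (map invLetter (u ++ v))                    ≡⟨ cong reverse (map-++ invLetter u v) ⟩
    reverse (map invLetter u ++ map invLetter v)        ≡⟨ reverse-++ (map invLetter u) (map invLetter v) ⟩
    inv v ++ inv u                                      ∎

  inv-involutive : (w : Word k) → inv (inv w) ≡ w
  inv-involutive w = begin
    reverse (map invLetter (reverse (map invLetter w))) ≡⟨ reverse-map invLetter (reverse (map invLetter w)) ⟨
    map invLetter (reverse (reverse (map invLetter w))) ≡⟨ cong (map invLetter) (reverse-involutive (map invLetter w)) ⟩
    map invLetter (map invLetter w)                     ≡⟨ map-invLetter-involutive w ⟩
    w                                                   ∎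
    where
    map-invLetter-involutive : (w : Word k) → map invLetter (map invLetter w) ≡ w
    map-invLetter-involutive []      = refl
    map-invLetter-involutive (a ∷ w) = cong₂ _∷_ (invLetter-involutive a) (map-invLetter-involutive w)

  length-inv : (w : Word k) → length (inv w) ≡ length w
  length-inv w = trans (length-reverse (map invLetter w)) (length-map invLetter w)

  inv-∷ʳ : (w : Word k) (a : Letter k) → inv (w ++ [ a ]) ≡ invLetter a ∷ inv w
  inv-∷ʳ w a = inv-++ w [ a ]

  inv-swap : (u v : Word k) (a b : Letter k) →
             inv (u ++ a ∷ b ∷ v) ≡ inv v ++ invLetter b ∷ invLetter a ∷ inv u
  inv-swap u v a b = begin
    inv (u ++ a ∷ b ∷ v)                                ≡⟨ inv-++ u (a ∷ b ∷ v) ⟩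
    inv (a ∷ b ∷ v) ++ inv u                            ≡⟨ cong (_++ inv u) (inv-++ (a ∷ b ∷ []) v) ⟩
    (inv v ++ invLetter b ∷ invLetter a ∷ []) ++ inv u  ≡⟨ ++-assoc (inv v) _ (inv u) ⟩
    inv v ++ invLetter b ∷ invLetter a ∷ inv u          ∎

module _ {k : ℕ} (F : PairSet k) where

  infix 4 _≈_
  _≈_ : Word k → Word k → Set
  u ≈ v = u ≈[ F ] v

  ≈-setoid : Setoid _ _
  ≈-setoid = record
    { Carrier = Word k ; _≈_ = _≈_
    ; isEquivalence = record { refl = ≈-refl ; sym = ≈-sym ; trans = ≈-trans } }

  module ≈-Reasoning = SetoidReasoning ≈-setoid

  ≈-reflexive : ∀ {u v} → u ≡ v → u ≈ v
  ≈-reflexive refl = ≈-refl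

  ≈-++ʳ : ∀ {u v} w → u ≈ v → u ++ w ≈ v ++ w
  ≈-++ʳ w ≈-refl          = ≈-refl
  ≈-++ʳ w (≈-sym p)       = ≈-sym (≈-++ʳ w p)
  ≈-++ʳ w (≈-trans p q)   = ≈-trans (≈-++ʳ w p) (≈-++ʳ w q)
  ≈-++ʳ w (≈-cancel u v a) =
    ≈-trans (≈-reflexive (++-assoc u (a ∷ invLetter a ∷ v) w))
      (≈-trans (≈-cancel u (v ++ w) a) (≈-reflexive (sym (++-assoc u v w))))
  ≈-++ʳ w (≈-comm u v i j b c ij) =
    ≈-trans (≈-reflexive (++-assoc u _ w))
      (≈-trans (≈-comm u (v ++ w) i j b c ij) (≈-reflexive (sym (++-assoc u _ w))))

  ≈-++ˡ : ∀ {u v} w → u ≈ v → w ++ u ≈ w ++ v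
  ≈-++ˡ w ≈-refl          = ≈-refl
  ≈-++ˡ w (≈-sym p)       = ≈-sym (≈-++ˡ w p)
  ≈-++ˡ w (≈-trans p q)   = ≈-trans (≈-++ˡ w p) (≈-++ˡ w q)
  ≈-++ˡ w (≈-cancel u v a) =
    ≈-trans (≈-reflexive (sym (++-assoc w u (a ∷ invLetter a ∷ v))))
      (≈-trans (≈-cancel (w ++ u) v a) (≈-reflexive (++-assoc w u v)))
  ≈-++ˡ w (≈-comm u v i j b c ij) =
    ≈-trans (≈-reflexive (sym (++-assoc w u _)))
      (≈-trans (≈-comm (w ++ u) v i j b c ij) (≈-reflexive (++-assoc w u _)))

  ≈-∷ : ∀ {u v} a → u ≈ v → a ∷ u ≈ a ∷ v
  ≈-∷ a = ≈-++ˡ [ a ]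

  ≈-++ : ∀ {u u′ v v′} → u ≈ u′ → v ≈ v′ → u ++ v ≈ u′ ++ v′
  ≈-++ {u′ = u′} {v = v} p q = ≈-trans (≈-++ʳ v p) (≈-++ˡ u′ q)

  ≈-inv : ∀ {u v} → u ≈ v → inv u ≈ inv v
  ≈-inv ≈-refl        = ≈-refl
  ≈-inv (≈-sym p)     = ≈-sym (≈-inv p)
  ≈-inv (≈-trans p q) = ≈-trans (≈-inv p) (≈-inv q)
  ≈-inv (≈-cancel u v a) = begin
    inv (u ++ a ∷ invLetter a ∷ v)                               ≡⟨ inv-swap u v a (invLetter a) ⟩
    inv v ++ invLetter (invLetter a) ∷ invLetter a ∷ inv u
      ≡⟨ cong (λ b → inv v ++ b ∷ invLetter a ∷ inv u) (invLetter-involutive a) ⟩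
    inv v ++ a ∷ invLetter a ∷ inv u                             ≈⟨ ≈-cancel (inv v) (inv u) a ⟩
    inv v ++ inv u                                               ≡⟨ inv-++ u v ⟨
    inv (u ++ v)                                                 ∎
    where open ≈-Reasoning
  ≈-inv (≈-comm u v i j b c (i≢j , Fij , Fji)) = begin
    inv (u ++ (i , b) ∷ (j , c) ∷ v)               ≡⟨ inv-swap u v (i , b) (j , c) ⟩
    inv v ++ (j , not c) ∷ (i , not b) ∷ inv u     ≈⟨ ≈-comm (inv v) (inv u) j i (not c) (not b) (i≢j ∘ sym , Fji , Fij) ⟩
    inv v ++ (i , not b) ∷ (j , not c) ∷ inv u     ≡⟨ inv-swap u v (j , c) (i , b) ⟨
    inv (u ++ (j , c) ∷ (i , b) ∷ v)               ∎
    where open ≈-Reasoning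

  cancel-∷ : ∀ a w → a ∷ invLetter a ∷ w ≈ w
  cancel-∷ a w = ≈-cancel [] w a

  cancel⁻¹-∷ : ∀ a w → invLetter a ∷ a ∷ w ≈ w
  cancel⁻¹-∷ a w = subst (λ b → invLetter a ∷ b ∷ w ≈ w) (invLetter-involutive a) (cancel-∷ (invLetter a) w)

  inverseʳ : ∀ w → w ++ inv w ≈ []
  inverseʳ []      = ≈-refl
  inverseʳ (a ∷ w) = begin
    a ∷ w ++ inv (a ∷ w)              ≡⟨ cong (λ v → a ∷ w ++ v) (inv-++ [ a ] w) ⟩
    a ∷ w ++ inv w ++ [ invLetter a ] ≡⟨ cong (a ∷_) (++-assoc w (inv w) _) ⟨
    a ∷ (w ++ inv w) ++ [ invLetter a ] ≈⟨ ≈-∷ a (≈-++ʳ _ (inverseʳ w)) ⟩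
    a ∷ invLetter a ∷ []              ≈⟨ cancel-∷ a [] ⟩
    []                                ∎
    where open ≈-Reasoning

  inverseˡ : ∀ w → inv w ++ w ≈ []
  inverseˡ w = subst (λ v → inv w ++ v ≈ []) (inv-involutive w) (inverseʳ (inv w))

  cancel-inverseʳ : ∀ u w v → u ++ w ++ inv w ++ v ≈ u ++ v
  cancel-inverseʳ u w v = ≈-++ˡ u (≈-trans (≈-reflexive (sym (++-assoc w (inv w) v))) (≈-++ʳ v (inverseʳ w)))

  cancel-inverseˡ : ∀ u w v → u ++ inv w ++ w ++ v ≈ u ++ v
  cancel-inverseˡ u w v = ≈-++ˡ u (≈-trans (≈-reflexive (sym (++-assoc (inv w) w v))) (≈-++ʳ v (inverseˡ w)))

  -- Normal forms

  dependent : Letter k → Letter k → Bool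
  dependent (i , _) (j , _) = ⌊ i Fin.≟ j ⌋ ∨ F i j ∨ F j i

  dependent-refl : ∀ a → dependent a a ≡ true
  dependent-refl (i , _) with i Fin.≟ i
  ... | yes _  = refl
  ... | no i≢i = ⊥-elim (i≢i refl)

  dependent-sym : ∀ a b → dependent a b ≡ dependent b a
  dependent-sym (i , _) (j , _) with i Fin.≟ j | j Fin.≟ i
  ... | yes _   | yes _   = refl
  ... | yes i≡j | no j≢i  = ⊥-elim (j≢i (sym i≡j))
  ... | no i≢j  | yes j≡i = ⊥-elim (i≢j (sym j≡i))
  ... | no _    | no _    = Bool.∨-comm (F i j) (F j i)

  independent-sym : ∀ a b → dependent a b ≡ false → dependent b a ≡ false
  independent-sym a b ab = trans (dependent-sym b a) ab

  independent⇒commuting : ∀ {a b} → dependent a b ≡ false → Commuting F (proj₁ a) (proj₁ b)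
  independent⇒commuting {i , _} {j , _} ab with i Fin.≟ j | F i j | F j i
  ... | no i≢j | false | false = i≢j , refl , refl

  commuting⇒independent : ∀ {i j b c} → Commuting F i j → dependent (i , b) (j , c) ≡ false
  commuting⇒independent {i} {j} (i≢j , Fij , Fji) with i Fin.≟ j
  ... | yes i≡j = ⊥-elim (i≢j i≡j)
  ... | no _ rewrite Fij | Fji = refl

  Independent : Letter k → Word k → Set
  Independent a = All (λ b → dependent a b ≡ false)

  _≟ₗ_ : (a b : Letter k) → Dec (a ≡ b)
  _≟ₗ_ = ≡-dec Fin._≟_ Bool._≟_

  deleteStep : {P : Set} → Bool → Dec P → Letter k → Word k → Maybe (Word k) → Maybe (Word k)
  deleteStep true  (yes _) b r m = just r
  deleteStep true  (no _)  b r m = nothing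
  deleteStep false _       b r m = Maybe.map (b ∷_) m

  -- delete a r cancels a against the first letter of r that is dependent on a,
  -- provided that letter is a⁻¹.
  delete : Letter k → Word k → Maybe (Word k)
  delete a []      = nothing
  delete a (b ∷ r) = deleteStep (dependent a b) (b ≟ₗ invLetter a) b r (delete a r)

  push : Letter k → Word k → Word k
  push a r = fromMaybe (a ∷ r) (delete a r)

  normalForm : Word k → Word k
  normalForm []      = []
  normalForm (a ∷ w) = push a (normalForm w)

  pushAll : Word k → Word k → Word k
  pushAll []      r = r
  pushAll (a ∷ u) r = push a (pushAll u r)

  normalForm-++ : ∀ u w → normalForm (u ++ w) ≡ pushAll u (normalForm w)
  normalForm-++ []      w = refl
  normalForm-++ (a ∷ u) w = cong (push a) (normalForm-++ u w)

  delete-independent : ∀ a b r → dependent a b ≡ false → delete a (b ∷ r) ≡ Maybe.map (b ∷_) (delete a r)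
  delete-independent a b r ab rewrite ab = refl

  delete-blocked : ∀ a b r → dependent a b ≡ true → ¬ b ≡ invLetter a → delete a (b ∷ r) ≡ nothing
  delete-blocked a b r ab b≢a⁻¹ rewrite ab with b ≟ₗ invLetter a
  ... | yes b≡a⁻¹ = ⊥-elim (b≢a⁻¹ b≡a⁻¹)
  ... | no _      = refl

  delete-inverse : ∀ a r → delete a (invLetter a ∷ r) ≡ just r
  delete-inverse a r rewrite dependent-refl a with invLetter a ≟ₗ invLetter a
  ... | yes _ = refl
  ... | no ne = ⊥-elim (ne refl)

  delete-inverse⁻¹ : ∀ b r → delete (invLetter b) (b ∷ r) ≡ just r
  delete-inverse⁻¹ b r =
    subst (λ c → delete (invLetter b) (c ∷ r) ≡ just r) (invLetter-involutive b) (delete-inverse (invLetter b) r)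

  map-∷-just⁻ : ∀ (m : Maybe (Word k)) {s} b → Maybe.map (b ∷_) m ≡ just s → ∃[ t ] (m ≡ just t × s ≡ b ∷ t)
  map-∷-just⁻ (just t) b refl = t , refl , refl

  delete-split : ∀ a r {s} → delete a r ≡ just s →
    ∃[ r₁ ] ∃[ r₂ ] (r ≡ r₁ ++ invLetter a ∷ r₂ × s ≡ r₁ ++ r₂ × Independent a r₁)
  delete-split a (b ∷ r) eq with dependent a b in ab | b ≟ₗ invLetter a
  delete-split a (b ∷ r) refl | true  | yes refl = [] , r , refl , refl , []
  delete-split a (b ∷ r) eq   | false | _ with map-∷-just⁻ (delete a r) b eq
  ... | s , eq′ , refl with delete-split a r eq′
  ... | r₁ , r₂ , refl , refl , ind = b ∷ r₁ , r₂ , refl , refl , ab ∷ ind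

  commute-past : ∀ a {u} → Independent a u → ∀ v → a ∷ u ++ v ≈ u ++ a ∷ v
  commute-past a []               v = ≈-refl
  commute-past a {b ∷ u} (ab ∷ p) v =
    ≈-trans (≈-comm [] (u ++ v) (proj₁ a) (proj₁ b) (proj₂ a) (proj₂ b) (independent⇒commuting {a} {b} ab))
            (≈-∷ b (commute-past a p v))

  push-≈ : ∀ a r → push a r ≈ a ∷ r
  push-≈ a r with delete a r in eq
  ... | nothing = ≈-refl
  ... | just s with delete-split a r eq
  ... | r₁ , r₂ , refl , refl , ind =
    ≈-sym (≈-trans (commute-past a ind (invLetter a ∷ r₂)) (≈-cancel r₁ r₂ a))

  normalForm-≈ : ∀ w → normalForm w ≈ w
  normalForm-≈ []      = ≈-refl
  normalForm-≈ (a ∷ w) = ≈-trans (push-≈ a (normalForm w)) (≈-∷ a (normalForm-≈ w))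

  delete-length : ∀ a r {s} → delete a r ≡ just s → suc (length s) ≡ length r
  delete-length a r eq with delete-split a r eq
  ... | r₁ , r₂ , refl , refl , _ = sym (length-++-sucʳ r₁ _ r₂)

  length-push : ∀ a r → length (push a r) ≤ suc (length r)
  length-push a r with delete a r in eq
  ... | nothing = ≤-refl
  ... | just s  = m≤n⇒m≤1+n (≤-trans (n≤1+n (length s)) (≤-reflexive (delete-length a r eq)))

  length-normalForm : ∀ w → length (normalForm w) ≤ length w
  length-normalForm []      = z≤n
  length-normalForm (a ∷ w) = ≤-trans (length-push a (normalForm w)) (s≤s (length-normalForm w))

  data Reduced : Word k → Set where
    []  : Reduced []
    _∷_ : ∀ {b r} → delete b r ≡ nothing → Reduced r → Reduced (b ∷ r)

  delete-preserves-nothing : ∀ a b r {s} → dependent a b ≡ false →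
    delete a r ≡ just s → delete b r ≡ nothing → delete b s ≡ nothing
  delete-preserves-nothing a b (c ∷ r) ab eq nb with dependent a c in ac | c ≟ₗ invLetter a
  delete-preserves-nothing a b (c ∷ r) ab refl nb | true | yes refl
    rewrite dependent-sym b (invLetter a) | ab with delete b r
  ... | nothing = refl
  delete-preserves-nothing a b (c ∷ r) ab eq nb | false | _ with map-∷-just⁻ (delete a r) c eq
  ... | s , eq′ , refl with dependent b c | c ≟ₗ invLetter b
  ... | true  | no _ = refl
  ... | false | _ with delete b r in nb′
  ... | nothing rewrite delete-preserves-nothing a b r ab eq′ nb′ = refl

  Reduced-delete : ∀ a r {s} → Reduced r → delete a r ≡ just s → Reduced s
  Reduced-delete a (b ∷ r) (nb ∷ red) eq with dependent a b in ab | b ≟ₗ invLetter a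
  Reduced-delete a (b ∷ r) (nb ∷ red) refl | true  | yes refl = red
  Reduced-delete a (b ∷ r) (nb ∷ red) eq   | false | _ with map-∷-just⁻ (delete a r) b eq
  ... | s , eq′ , refl = delete-preserves-nothing a b r ab eq′ nb ∷ Reduced-delete a r red eq′

  Reduced-push : ∀ a r → Reduced r → Reduced (push a r)
  Reduced-push a r red with delete a r in eq
  ... | nothing = eq ∷ red
  ... | just s  = Reduced-delete a r red eq

  Reduced-normalForm : ∀ w → Reduced (normalForm w)
  Reduced-normalForm []      = []
  Reduced-normalForm (a ∷ w) = Reduced-push a (normalForm w) (Reduced-normalForm w)

  normalForm-Reduced : ∀ {w} → Reduced w → normalForm w ≡ w
  normalForm-Reduced []                  = refl
  normalForm-Reduced (nb ∷ red) rewrite normalForm-Reduced red | nb = refl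

  length-normalForm≡⇒Reduced : ∀ w → length (normalForm w) ≡ length w → Reduced w
  length-normalForm≡⇒Reduced []      eq = []
  length-normalForm≡⇒Reduced (a ∷ w) eq with delete a (normalForm w) in da
  ... | nothing with length-normalForm≡⇒Reduced w (suc-injective eq)
  ... | red rewrite normalForm-Reduced red = da ∷ red
  length-normalForm≡⇒Reduced (a ∷ w) eq | just s = ⊥-elim (m+n≮n 1 _ too-long)
    where
    too-long : suc (suc (length w)) ≤ length w
    too-long = subst (_≤ length w) (sym (trans (cong suc (sym eq)) (delete-length a (normalForm w) da)))
                     (length-normalForm w)

  -- Equality up to swapping adjacent independent letters: normal forms of
  -- equal elements agree up to it.
  infix 4 _∼_
  data _∼_ : Word k → Word k → Set where
    ∼-refl  : ∀ {r} → r ∼ r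
    ∼-sym   : ∀ {r s} → r ∼ s → s ∼ r
    ∼-trans : ∀ {r s t} → r ∼ s → s ∼ t → r ∼ t
    ∼-swap  : ∀ u v b c → dependent b c ≡ false → u ++ b ∷ c ∷ v ∼ u ++ c ∷ b ∷ v

  ∼-reflexive : ∀ {u v} → u ≡ v → u ∼ v
  ∼-reflexive refl = ∼-refl

  ∼-∷ : ∀ a {r s} → r ∼ s → a ∷ r ∼ a ∷ s
  ∼-∷ a ∼-refl               = ∼-refl
  ∼-∷ a (∼-sym p)            = ∼-sym (∼-∷ a p)
  ∼-∷ a (∼-trans p q)        = ∼-trans (∼-∷ a p) (∼-∷ a q)
  ∼-∷ a (∼-swap u v b c bc)  = ∼-swap (a ∷ u) v b c bc

  ∼-length : ∀ {r s} → r ∼ s → length r ≡ length s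
  ∼-length ∼-refl              = refl
  ∼-length (∼-sym p)           = sym (∼-length p)
  ∼-length (∼-trans p q)       = trans (∼-length p) (∼-length q)
  ∼-length (∼-swap u v b c bc) = trans (length-++ u) (sym (length-++ u))

  delete-swap : ∀ a u v b c → dependent b c ≡ false →
    Pointwise _∼_ (delete a (u ++ b ∷ c ∷ v)) (delete a (u ++ c ∷ b ∷ v))
  delete-swap a (d ∷ u) v b c bc with dependent a d | d ≟ₗ invLetter a
  ... | true  | yes _ = just (∼-swap u v b c bc)
  ... | true  | no _  = nothing
  ... | false | _     with delete a (u ++ b ∷ c ∷ v) | delete a (u ++ c ∷ b ∷ v) | delete-swap a u v b c bc
  ... | _ | _ | just p  = just (∼-∷ d p)
  ... | _ | _ | nothing = nothing
  delete-swap a [] v b c bc with dependent a b in ab | dependent a c in ac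
  delete-swap a [] v b c bc | true | true with b ≟ₗ invLetter a | c ≟ₗ invLetter a
  ... | yes refl | _        = contradiction (trans (sym ac) bc) λ ()
  ... | no _     | yes refl = contradiction (trans (sym ab) (trans (dependent-sym a b) bc)) λ ()
  ... | no _     | no _     = nothing
  delete-swap a [] v b c bc | true | false with b ≟ₗ invLetter a
  ... | yes _ = just ∼-refl
  ... | no _  = nothing
  delete-swap a [] v b c bc | false | true with c ≟ₗ invLetter a
  ... | yes _ = just ∼-refl
  ... | no _  = nothing
  delete-swap a [] v b c bc | false | false with delete a v
  ... | nothing = nothing
  ... | just s  = just (∼-swap [] s b c bc)

  push-swap : ∀ a u v b c → dependent b c ≡ false → push a (u ++ b ∷ c ∷ v) ∼ push a (u ++ c ∷ b ∷ v)
  push-swap a u v b c bc with delete a (u ++ b ∷ c ∷ v) | delete a (u ++ c ∷ b ∷ v) | delete-swap a u v b c bc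
  ... | nothing | nothing | nothing = ∼-∷ a (∼-swap u v b c bc)
  ... | just _  | just _  | just p  = p

  push-cong : ∀ a {r s} → r ∼ s → push a r ∼ push a s
  push-cong a ∼-refl              = ∼-refl
  push-cong a (∼-sym p)           = ∼-sym (push-cong a p)
  push-cong a (∼-trans p q)       = ∼-trans (push-cong a p) (push-cong a q)
  push-cong a (∼-swap u v b c bc) = push-swap a u v b c bc

  pushAll-cong : ∀ u {r s} → r ∼ s → pushAll u r ∼ pushAll u s
  pushAll-cong []      p = p
  pushAll-cong (a ∷ u) p = push-cong a (pushAll-cong u p)

  delete-comm : ∀ a b r {s t} → dependent a b ≡ false → delete a r ≡ just s → delete b r ≡ just t →
    ∃[ w ] (delete b s ≡ just w × delete a t ≡ just w)
  delete-comm a b (d ∷ r) ab da db with dependent a d in ad | d ≟ₗ invLetter a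
  delete-comm a b (d ∷ r) ab refl db | true | yes refl
    with map-∷-just⁻ (delete b r) _
           (trans (sym (delete-independent b (invLetter a) r (independent-sym (invLetter a) b ab))) db)
  ... | t , db′ , refl = t , db′ , delete-inverse a t
  delete-comm a b (d ∷ r) ab da db | false | _ with dependent b d in bd | d ≟ₗ invLetter b
  delete-comm a b (d ∷ r) ab da refl | false | _ | true | yes refl with map-∷-just⁻ (delete a r) _ da
  ... | s , da′ , refl = s , delete-inverse b s , da′
  delete-comm a b (d ∷ r) ab da db | false | _ | false | _
    with map-∷-just⁻ (delete a r) _ da | map-∷-just⁻ (delete b r) _ db
  ... | s , da′ , refl | t , db′ , refl with delete-comm a b r ab da′ db′
  ... | w , p , q = d ∷ w , trans (delete-independent b d s bd) (Maybe-map-just p)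
                          , trans (delete-independent a d t ad) (Maybe-map-just q)

  push-comm : ∀ a c r → dependent a c ≡ false → push a (push c r) ∼ push c (push a r)
  push-comm a c r ac with delete c r in dc | delete a r in da
  ... | nothing | nothing
    rewrite delete-independent a c r ac | delete-independent c a r (independent-sym a c ac) | da | dc =
      ∼-swap [] r a c ac
  ... | just t | nothing
    rewrite delete-preserves-nothing c a r (independent-sym a c ac) dc da
          | delete-independent c a r (independent-sym a c ac) | dc = ∼-refl
  ... | nothing | just s
    rewrite delete-preserves-nothing a c r ac da dc | delete-independent a c r ac | da = ∼-refl
  ... | just t | just s with delete-comm c a r (independent-sym a c ac) dc da
  ... | w , p , q rewrite p | q = ∼-refl

  delete-inverse-reduced : ∀ c r {s} → Reduced r → delete c r ≡ just s →
    delete (invLetter c) s ≡ nothing × invLetter c ∷ s ∼ r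
  delete-inverse-reduced c (d ∷ r) (nd ∷ red) eq with dependent c d in cd | d ≟ₗ invLetter c
  delete-inverse-reduced c (d ∷ r) (nd ∷ red) refl | true  | yes refl = nd , ∼-refl
  delete-inverse-reduced c (d ∷ r) (nd ∷ red) eq   | false | _ with map-∷-just⁻ (delete c r) d eq
  ... | s , eq′ , refl with delete-inverse-reduced c r red eq′
  ... | ns , p = trans (delete-independent (invLetter c) d s cd) (cong (Maybe.map (d ∷_)) ns)
               , ∼-trans (∼-swap [] s (invLetter c) d cd) (∼-∷ d p)

  push-inverse : ∀ a r → Reduced r → push a (push (invLetter a) r) ∼ r
  push-inverse a r red with delete (invLetter a) r in eq
  ... | nothing rewrite delete-inverse a r = ∼-refl
  ... | just s with delete-inverse-reduced (invLetter a) r red eq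
  ... | ns , p rewrite invLetter-involutive a | ns = p

  normalForm-cong : ∀ {u v} → u ≈ v → normalForm u ∼ normalForm v
  normalForm-cong ≈-refl        = ∼-refl
  normalForm-cong (≈-sym p)     = ∼-sym (normalForm-cong p)
  normalForm-cong (≈-trans p q) = ∼-trans (normalForm-cong p) (normalForm-cong q)
  normalForm-cong (≈-cancel u v a) =
    ∼-trans (∼-reflexive (normalForm-++ u (a ∷ invLetter a ∷ v)))
      (∼-trans (pushAll-cong u (push-inverse a (normalForm v) (Reduced-normalForm v)))
               (∼-reflexive (sym (normalForm-++ u v))))
  normalForm-cong (≈-comm u v i j b c ij) =
    ∼-trans (∼-reflexive (normalForm-++ u ((i , b) ∷ (j , c) ∷ v)))
      (∼-trans (pushAll-cong u (push-comm (i , b) (j , c) (normalForm v) (commuting⇒independent {b = b} {c = c} ij)))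
               (∼-reflexive (sym (normalForm-++ u _))))

  norm : Word k → ℕ
  norm w = length (normalForm w)

  norm-cong : ∀ {u v} → u ≈ v → norm u ≡ norm v
  norm-cong p = ∼-length (normalForm-cong p)

  Norm-norm : ∀ w → Norm F w (norm w)
  Norm-norm w = (normalForm w , normalForm-≈ w , refl)
              , λ v v≈w → ≤-trans (≤-reflexive (norm-cong (≈-sym v≈w))) (length-normalForm v)

  Norm⇒≡norm : ∀ {w n} → Norm F w n → n ≡ norm w
  Norm⇒≡norm {w} ((v , v≈w , refl) , minimal) =
    ≤-antisym (minimal (normalForm w) (normalForm-≈ w))
              (≤-trans (≤-reflexive (norm-cong (≈-sym v≈w))) (length-normalForm v))

  -- The word metric

  norm-++ : ∀ u v → norm (u ++ v) ≤ norm u + norm v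
  norm-++ u v = begin
    norm (u ++ v)                               ≡⟨ norm-cong (≈-++ (normalForm-≈ u) (normalForm-≈ v)) ⟨
    norm (normalForm u ++ normalForm v)         ≤⟨ length-normalForm (normalForm u ++ normalForm v) ⟩
    length (normalForm u ++ normalForm v)       ≡⟨ length-++ (normalForm u) ⟩
    norm u + norm v                             ∎
    where open ≤-Reasoning

  norm-∷ : ∀ c w → norm (c ∷ w) ≤ suc (norm w)
  norm-∷ c w = norm-++ [ c ] w

  norm-inv≤ : ∀ u → norm (inv u) ≤ norm u
  norm-inv≤ u = begin
    norm (inv u)                ≡⟨ norm-cong (≈-inv (normalForm-≈ u)) ⟨
    norm (inv (normalForm u))   ≤⟨ length-normalForm (inv (normalForm u)) ⟩
    length (inv (normalForm u)) ≡⟨ length-inv (normalForm u) ⟩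
    norm u                      ∎
    where open ≤-Reasoning

  norm-inv : ∀ u → norm (inv u) ≡ norm u
  norm-inv u = ≤-antisym (norm-inv≤ u) (subst (λ v → norm v ≤ norm (inv u)) (inv-involutive u) (norm-inv≤ (inv u)))

  norm≡0⇒≈[] : ∀ {w} → norm w ≡ 0 → w ≈ []
  norm≡0⇒≈[] {w} eq with normalForm w in nf
  ... | [] = ≈-trans (≈-sym (normalForm-≈ w)) (≈-reflexive nf)

  -- c is a descent of w when some reduced spelling of w begins with c⁻¹.
  Descent : Letter k → Word k → Set
  Descent c w = suc (norm (c ∷ w)) ≡ norm w

  Descent? : ∀ c w → Dec (Descent c w)
  Descent? c w = suc (norm (c ∷ w)) ≟ norm w

  delete⇒Descent : ∀ {c w s} → delete c (normalForm w) ≡ just s → Descent c w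
  delete⇒Descent {c} {w} eq =
    trans (cong (λ m → suc (length (fromMaybe (c ∷ normalForm w) m))) eq) (delete-length c (normalForm w) eq)

  descent⊎ascent : ∀ c w → Descent c w ⊎ norm (c ∷ w) ≡ suc (norm w)
  descent⊎ascent c w with delete c (normalForm w) in eq
  ... | nothing = inj₂ refl
  ... | just s  = inj₁ (delete-length c (normalForm w) eq)

  Descent⇒delete : ∀ {c w} → Descent c w → ∃[ s ] (delete c (normalForm w) ≡ just s)
  Descent⇒delete {c} {w} descent with delete c (normalForm w)
  ... | just s  = s , refl
  ... | nothing = ⊥-elim (m+n≮n 1 _ (≤-reflexive descent))

  ¬Descent⇒delete≡nothing : ∀ {c w} → ¬ Descent c w → delete c (normalForm w) ≡ nothing
  ¬Descent⇒delete≡nothing {c} {w} ¬descent with delete c (normalForm w) in eq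
  ... | nothing = refl
  ... | just s  = ⊥-elim (¬descent (delete-length c (normalForm w) eq))

  ¬Descent⇒ascent : ∀ {c w} → ¬ Descent c w → norm (c ∷ w) ≡ suc (norm w)
  ¬Descent⇒ascent {c} {w} ¬descent with descent⊎ascent c w
  ... | inj₁ descent = ⊥-elim (¬descent descent)
  ... | inj₂ ascent  = ascent

  Descent-cong : ∀ {c u v} → u ≈ v → Descent c u → Descent c v
  Descent-cong {c} u≈v descent = trans (cong suc (norm-cong (≈-∷ c (≈-sym u≈v)))) (trans descent (norm-cong u≈v))

  dist : Word k → Word k → ℕ
  dist x y = norm (inv x ++ y)

  dist-cong : ∀ {x x′ y y′} → x ≈ x′ → y ≈ y′ → dist x y ≡ dist x′ y′
  dist-cong p q = norm-cong (≈-++ (≈-inv p) q)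

  dist-sym : ∀ x y → dist x y ≡ dist y x
  dist-sym x y = begin
    norm (inv x ++ y)              ≡⟨ norm-inv (inv x ++ y) ⟨
    norm (inv (inv x ++ y))        ≡⟨ cong norm (inv-++ (inv x) y) ⟩
    norm (inv y ++ inv (inv x))    ≡⟨ cong (λ v → norm (inv y ++ v)) (inv-involutive x) ⟩
    norm (inv y ++ x)              ∎
    where open ≡-Reasoning

  dist-triangle : ∀ x y z → dist x z ≤ dist x y + dist y z
  dist-triangle x y z = ≤-trans (≤-reflexive (norm-cong x⁻¹z≈x⁻¹yy⁻¹z)) (norm-++ (inv x ++ y) (inv y ++ z))
    where
    x⁻¹z≈x⁻¹yy⁻¹z : inv x ++ z ≈ (inv x ++ y) ++ inv y ++ z
    x⁻¹z≈x⁻¹yy⁻¹z = ≈-sym (≈-trans (≈-reflexive (++-assoc (inv x) y (inv y ++ z))) (cancel-inverseʳ (inv x) y z))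

  dist-translate : ∀ g x y → dist (g ++ x) (g ++ y) ≡ dist x y
  dist-translate g x y = norm-cong (begin
    inv (g ++ x) ++ g ++ y       ≡⟨ cong (_++ g ++ y) (inv-++ g x) ⟩
    (inv x ++ inv g) ++ g ++ y   ≡⟨ ++-assoc (inv x) (inv g) (g ++ y) ⟩
    inv x ++ inv g ++ g ++ y     ≈⟨ cancel-inverseˡ (inv x) g y ⟩
    inv x ++ y                   ∎)
    where open ≈-Reasoning

  dist-[]ʳ : ∀ x → dist x [] ≡ norm x
  dist-[]ʳ x = trans (cong norm (++-identityʳ (inv x))) (norm-inv x)

  dist-++ʳ : ∀ w r → dist w (w ++ r) ≡ norm r
  dist-++ʳ w r = trans (cong (λ v → dist v (w ++ r)) (sym (++-identityʳ w))) (dist-translate w [] r)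

  dist≡0⇒≈ : ∀ {x y} → dist x y ≡ 0 → x ≈ y
  dist≡0⇒≈ {x} {y} eq = begin
    x                    ≡⟨ ++-identityʳ x ⟨
    x ++ []              ≈⟨ ≈-++ˡ x (norm≡0⇒≈[] eq) ⟨
    x ++ inv x ++ y      ≡⟨ ++-assoc x (inv x) y ⟨
    (x ++ inv x) ++ y    ≈⟨ ≈-++ʳ y (inverseʳ x) ⟩
    y                    ∎
    where open ≈-Reasoning

  Between : Word k → Word k → Word k → Set
  Between x y z = dist x y + dist y z ≡ dist x z

  -- The paper's x ≤ y: x lies on a geodesic from 1 to y.
  infix 4 _≼_
  _≼_ : Word k → Word k → Set
  x ≼ y = Between [] x y

  Between-cong : ∀ {x x′ y y′ z z′} → x ≈ x′ → y ≈ y′ → z ≈ z′ → Between x y z → Between x′ y′ z′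
  Between-cong p q r b = trans (cong₂ _+_ (sym (dist-cong p q)) (sym (dist-cong q r))) (trans b (dist-cong p r))

  ≼-cong : ∀ {u u′ v v′} → u ≈ u′ → v ≈ v′ → u ≼ v → u′ ≼ v′
  ≼-cong = Between-cong {[]} ≈-refl

  Between-translate : ∀ g {x y z} → Between x y z → Between (g ++ x) (g ++ y) (g ++ z)
  Between-translate g {x} {y} {z} b =
    trans (cong₂ _+_ (dist-translate g x y) (dist-translate g y z)) (trans b (sym (dist-translate g x z)))

  between-inner : ∀ {x w y z} → Between x w y → Between x y z → Between x w z × Between w y z
  between-inner {x} {w} {y} {z} xwy xyz = xwz , wyz
    where
    xz≡ : dist x z ≡ dist x w + (dist w y + dist y z)
    xz≡ = trans (sym xyz) (trans (cong (_+ dist y z) (sym xwy)) (+-assoc (dist x w) (dist w y) (dist y z)))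
    xwz : Between x w z
    xwz = ≤-antisym (≤-trans (+-monoʳ-≤ (dist x w) (dist-triangle w y z)) (≤-reflexive (sym xz≡)))
                    (dist-triangle x w z)
    wyz : Between w y z
    wyz = ≤-antisym (+-cancelˡ-≤ (dist x w) _ _ (≤-reflexive (trans (sym xz≡) (sym xwz))))
                    (dist-triangle w y z)

  between-outer : ∀ {x y z w} → Between x y z → Between y w z → Between x w z × Between x y w
  between-outer {x} {y} {z} {w} xyz ywz = xwz , xyw
    where
    xz≡ : dist x z ≡ dist x y + dist y w + dist w z
    xz≡ = trans (sym xyz) (trans (cong (dist x y +_) (sym ywz)) (sym (+-assoc (dist x y) (dist y w) (dist w z))))
    xwz : Between x w z
    xwz = ≤-antisym (≤-trans (+-monoˡ-≤ (dist w z) (dist-triangle x y w)) (≤-reflexive (sym xz≡)))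
                    (dist-triangle x w z)
    xyw : Between x y w
    xyw = +-cancelʳ-≡ (dist w z) _ _ (trans (sym xz≡) (sym xwz))

  ≼-trans : ∀ {x y z} → x ≼ y → y ≼ z → x ≼ z
  ≼-trans {x} {y} {z} x≼y y≼z = proj₁ (between-inner {[]} {x} {y} {z} x≼y y≼z)

  ≼-≼⇒Between : ∀ {x y z} → x ≼ y → y ≼ z → Between x y z
  ≼-≼⇒Between {x} {y} {z} x≼y y≼z = proj₂ (between-inner {[]} {x} {y} {z} x≼y y≼z)

  ≼-antisym : ∀ {x y} → x ≼ y → y ≼ x → x ≈ y
  ≼-antisym {x} {y} x≼y y≼x = dist≡0⇒≈ (+-cancelˡ-≡ (norm x) _ 0 (≤-antisym x+xy≤x (+-monoʳ-≤ (norm x) z≤n)))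
    where
    x+xy≤x : norm x + dist x y ≤ norm x + 0
    x+xy≤x = begin
      norm x + dist x y              ≤⟨ +-monoʳ-≤ (norm x) (m≤m+n (dist x y) (dist y x)) ⟩
      norm x + (dist x y + dist y x) ≡⟨ +-assoc (norm x) (dist x y) (dist y x) ⟨
      norm x + dist x y + dist y x   ≡⟨ cong (_+ dist y x) x≼y ⟩
      norm y + dist y x              ≡⟨ y≼x ⟩
      norm x                         ≡⟨ +-identityʳ (norm x) ⟨
      norm x + 0                     ∎
      where open ≤-Reasoning

  -- Medians

  CommonDescent : Word k → Word k → Set
  CommonDescent x y = ∃[ c ] (Descent c x × Descent c y)

  CommonDescent? : ∀ x y → Dec (CommonDescent x y)
  CommonDescent? x y with Fin.any? (λ i → (Descent? (i , true) x ×-dec Descent? (i , true) y)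
                                     ⊎-dec (Descent? (i , false) x ×-dec Descent? (i , false) y))
  ... | yes (i , inj₁ (cx , cy)) = yes ((i , true) , cx , cy)
  ... | yes (i , inj₂ (cx , cy)) = yes ((i , false) , cx , cy)
  ... | no none = no λ where
    ((i , true)  , cx , cy) → none (i , inj₁ (cx , cy))
    ((i , false) , cx , cy) → none (i , inj₂ (cx , cy))

  normalForm-ascent : ∀ {a w} → ¬ Descent a w → normalForm (a ∷ w) ≡ a ∷ normalForm w
  normalForm-ascent {a} {w} ¬descent = cong (fromMaybe (a ∷ normalForm w)) (¬Descent⇒delete≡nothing {a} {w} ¬descent)

  Reduced-delete⇒Descent : ∀ {c w s} → Reduced w → delete c w ≡ just s → Descent c w
  Reduced-delete⇒Descent {c} {w} {s} red eq =
    delete⇒Descent {c} {w} (subst (λ v → delete c v ≡ just s) (sym (normalForm-Reduced red)) eq)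

  Descent⇒Reduced-delete : ∀ {c w} → Reduced w → Descent c w → ∃[ s ] (delete c w ≡ just s)
  Descent⇒Reduced-delete {c} {w} red descent =
    subst (λ v → ∃[ s ] (delete c v ≡ just s)) (normalForm-Reduced red) (Descent⇒delete {c} {w} descent)

  Descent-head : ∀ {b r} → Reduced (b ∷ r) → Descent (invLetter b) (b ∷ r)
  Descent-head {b} {r} red = Reduced-delete⇒Descent red (delete-inverse⁻¹ b r)

  descent-exists : ∀ {ν} → ¬ norm ν ≡ 0 → ∃[ c ] Descent c ν
  descent-exists {ν} ν≢0 = fromNormalForm (normalForm ν) refl
    where
    fromNormalForm : ∀ w → normalForm ν ≡ w → ∃[ c ] Descent c ν
    fromNormalForm []      eq = ⊥-elim (ν≢0 (cong length eq))
    fromNormalForm (b ∷ r) eq = invLetter b , delete⇒Descent {invLetter b} {ν}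
                                  (trans (cong (delete (invLetter b)) eq) (delete-inverse⁻¹ b r))

  Descent-≼ : ∀ {c ν x} → Descent c ν → ν ≼ x → Descent c x
  Descent-≼ {c} {ν} {x} cν ν≼x with descent⊎ascent c x
  ... | inj₁ cx     = cx
  ... | inj₂ ascent = ⊥-elim (m+n≮n 1 (norm x) too-long)
    where
    too-long : suc (suc (norm x)) ≤ norm x
    too-long = begin
      suc (suc (norm x))              ≡⟨ cong suc ascent ⟨
      suc (norm (c ∷ x))              ≡⟨ cong suc (norm-cong (≈-∷ c (cancel-inverseʳ [] ν x))) ⟨
      suc (norm (c ∷ ν ++ inv ν ++ x)) ≤⟨ s≤s (norm-++ (c ∷ ν) (inv ν ++ x)) ⟩
      suc (norm (c ∷ ν) + dist ν x)   ≡⟨ cong (_+ dist ν x) cν ⟩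
      norm ν + dist ν x               ≡⟨ ν≼x ⟩
      norm x                          ∎
      where open ≤-Reasoning

  ¬CommonDescent⇒≼-both⇒≈[] : ∀ {x y ν} → ¬ CommonDescent x y → ν ≼ x → ν ≼ y → ν ≈ []
  ¬CommonDescent⇒≼-both⇒≈[] {x} {y} {ν} none ν≼x ν≼y with norm ν ≟ 0
  ... | yes ν≡0 = norm≡0⇒≈[] ν≡0
  ... | no ν≢0 with descent-exists {ν} ν≢0
  ... | c , cν = ⊥-elim (none (c , Descent-≼ {c} {ν} cν ν≼x , Descent-≼ {c} {ν} cν ν≼y))

  Descent-past-ascent : ∀ {a c y} → ¬ Descent a y → Descent c (a ∷ y) → ¬ a ≡ invLetter c →
                        dependent c a ≡ false × Descent c y
  Descent-past-ascent {a} {c} {y} ¬ay cay a≢c⁻¹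
    with subst (λ v → ∃[ s ] (delete c v ≡ just s)) (normalForm-ascent {a} {y} ¬ay) (Descent⇒delete {c} {a ∷ y} cay)
       | dependent c a in ca
  ... | _ , del | true  = contradiction (trans (sym del) (delete-blocked c a (normalForm y) ca a≢c⁻¹)) λ ()
  ... | _ , del | false with map-∷-just⁻ (delete c (normalForm y)) a
                               (trans (sym (delete-independent c a (normalForm y) ca)) del)
  ... | _ , del′ , _ = refl , delete⇒Descent {c} {y} del′

  ¬CommonDescent-cancel : ∀ {b r y} → Reduced (b ∷ r) → ¬ CommonDescent (b ∷ r) y →
                          ¬ CommonDescent r (invLetter b ∷ y)
  ¬CommonDescent-cancel {b} {r} {y} red@(nb ∷ red′) none (c , cr , cb⁻¹y)
    with Descent⇒Reduced-delete red′ cr | c ≟ₗ b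
  ... | _ , cr-del | yes refl = contradiction (trans (sym cr-del) nb) λ ()
  ... | _ , cr-del | no c≢b
    with Descent-past-ascent {invLetter b} {c} {y} (λ b⁻¹y → none (invLetter b , Descent-head red , b⁻¹y)) cb⁻¹y
                             (c≢b ∘ sym ∘ invLetter-injective)
  ... | cb , cy =
    none (c , Reduced-delete⇒Descent red (trans (delete-independent c b r cb) (Maybe-map-just cr-del)) , cy)

  dist-cancel-head : ∀ b r y → dist (b ∷ r) y ≡ dist r (invLetter b ∷ y)
  dist-cancel-head b r y = trans (sym (dist-translate [ invLetter b ] (b ∷ r) y)) (dist-cong (cancel⁻¹-∷ b r) ≈-refl)

  ¬CommonDescent⇒dist≡length+norm : ∀ {x} y → Reduced x → ¬ CommonDescent x y → dist x y ≡ length x + norm y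
  ¬CommonDescent⇒dist≡length+norm y [] none = refl
  ¬CommonDescent⇒dist≡length+norm {b ∷ r} y red@(_ ∷ red′) none = begin
    dist (b ∷ r) y                  ≡⟨ dist-cancel-head b r y ⟩
    dist r (invLetter b ∷ y)
      ≡⟨ ¬CommonDescent⇒dist≡length+norm (invLetter b ∷ y) red′ (¬CommonDescent-cancel {b} {r} {y} red none) ⟩
    length r + norm (invLetter b ∷ y) ≡⟨ cong (length r +_) (¬Descent⇒ascent {invLetter b} {y} b⁻¹y-ascent) ⟩
    length r + suc (norm y)         ≡⟨ +-suc (length r) (norm y) ⟩
    suc (length r) + norm y         ∎
    where
    open ≡-Reasoning
    b⁻¹y-ascent : ¬ Descent (invLetter b) y
    b⁻¹y-ascent b⁻¹y = none (invLetter b , Descent-head red , b⁻¹y)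

  ¬CommonDescent⇒dist≡norm+norm : ∀ {x y} → ¬ CommonDescent x y → dist x y ≡ norm x + norm y
  ¬CommonDescent⇒dist≡norm+norm {x} {y} none =
    trans (dist-cong (≈-sym (normalForm-≈ x)) ≈-refl)
          (¬CommonDescent⇒dist≡length+norm y (Reduced-normalForm x)
             λ (c , cx , cy) → none (c , Descent-cong (normalForm-≈ x) cx , cy))

  delete-++ : ∀ c r v {t} → delete c r ≡ nothing → delete c (r ++ v) ≡ just t →
              Independent c r × ∃[ t′ ] (delete c v ≡ just t′)
  delete-++ c []      v _  eq = [] , _ , eq
  delete-++ c (b ∷ r) v nr eq with dependent c b in cb | b ≟ₗ invLetter c
  delete-++ c (b ∷ r) v () eq | true  | yes _
  delete-++ c (b ∷ r) v nr () | true  | no _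
  delete-++ c (b ∷ r) v nr eq | false | _ with delete c r in nr′ | delete c (r ++ v) in eq′
  ...   | nothing | just _ with delete-++ c r v nr′ eq′
  ...     | ind , rest = cb ∷ ind , rest

  Descent-++ : ∀ {c p s} → norm (p ++ s) ≡ norm p + norm s → Descent c (p ++ s) → ¬ Descent c p →
               Descent c s × Independent c (normalForm p)
  Descent-++ {c} {p} {s} geodesic cps ¬cp = delete⇒Descent {c} {s} (proj₂ (proj₂ split)) , proj₁ split
    where
    r = normalForm p
    v = normalForm s
    rv≈ps : r ++ v ≈ p ++ s
    rv≈ps = ≈-++ (normalForm-≈ p) (normalForm-≈ s)
    reduced : Reduced (r ++ v)
    reduced = length-normalForm≡⇒Reduced (r ++ v) (trans (norm-cong rv≈ps) (trans geodesic (sym (length-++ r))))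
    split : Independent c r × ∃[ t ] (delete c v ≡ just t)
    split = delete-++ c r v (¬Descent⇒delete≡nothing {c} {p} ¬cp)
              (proj₂ (Descent⇒Reduced-delete reduced (Descent-cong (≈-sym rv≈ps) cps)))

  commute-normalForm : ∀ a {w} → Independent a (normalForm w) → a ∷ w ≈ w ++ [ a ]
  commute-normalForm a {w} ind = begin
    a ∷ w                       ≈⟨ ≈-∷ a (normalForm-≈ w) ⟨
    a ∷ normalForm w            ≡⟨ cong (a ∷_) (++-identityʳ (normalForm w)) ⟨
    a ∷ normalForm w ++ []      ≈⟨ commute-past a ind [] ⟩
    normalForm w ++ [ a ]       ≈⟨ ≈-++ʳ [ a ] (normalForm-≈ w) ⟩
    w ++ [ a ]                  ∎
    where open ≈-Reasoning

  -- μ is the median of 1, x and y; it is the meet x ∧ y.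
  IsMedian : Word k → Word k → Word k → Set
  IsMedian x y μ = μ ≼ x × μ ≼ y × Between x μ y

  ≼-shift : ∀ {c ν z} → Descent c ν → ν ≼ z → c ∷ ν ≼ c ∷ z
  ≼-shift {c} {ν} {z} cν ν≼z = suc-injective (begin
    suc (norm (c ∷ ν) + dist (c ∷ ν) (c ∷ z)) ≡⟨ cong (λ n → suc (norm (c ∷ ν) + n)) (dist-translate [ c ] ν z) ⟩
    suc (norm (c ∷ ν)) + dist ν z             ≡⟨ cong (_+ dist ν z) cν ⟩
    norm ν + dist ν z                         ≡⟨ ν≼z ⟩
    norm z                                    ≡⟨ Descent-≼ {c} {ν} cν ν≼z ⟨
    suc (norm (c ∷ z))                        ∎)
    where open ≡-Reasoning

  ≼-unshift : ∀ {c μ z} → Descent c z → μ ≼ c ∷ z → invLetter c ∷ μ ≼ z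
  ≼-unshift {c} {μ} {z} cz μ≼cz = ≤-antisym (begin
    norm (invLetter c ∷ μ) + dist (invLetter c ∷ μ) z ≡⟨ cong (norm (invLetter c ∷ μ) +_) dist≡ ⟩
    norm (invLetter c ∷ μ) + dist μ (c ∷ z)           ≤⟨ +-monoˡ-≤ _ (norm-∷ (invLetter c) μ) ⟩
    suc (norm μ + dist μ (c ∷ z))                     ≡⟨ cong suc μ≼cz ⟩
    suc (norm (c ∷ z))                                ≡⟨ cz ⟩
    norm z                                            ∎) (dist-triangle [] (invLetter c ∷ μ) z)
    where
    open ≤-Reasoning
    dist≡ : dist (invLetter c ∷ μ) z ≡ dist μ (c ∷ z)
    dist≡ = trans (sym (dist-translate [ c ] (invLetter c ∷ μ) z)) (dist-cong (cancel-∷ c μ) ≈-refl)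

  IsMedian-shift : ∀ {c x y ν} → Descent c ν → IsMedian x y ν → IsMedian (c ∷ x) (c ∷ y) (c ∷ ν)
  IsMedian-shift {c} {x} {y} {ν} cν (ν≼x , ν≼y , xνy) =
    ≼-shift {c} {ν} cν ν≼x , ≼-shift {c} {ν} cν ν≼y , Between-translate [ c ] {x} {ν} {y} xνy

  IsMedian-unshift : ∀ {c x y μ} → Descent c x → Descent c y → IsMedian (c ∷ x) (c ∷ y) μ →
                     IsMedian x y (invLetter c ∷ μ)
  IsMedian-unshift {c} {x} {y} {μ} cx cy (μ≼cx , μ≼cy , cxμcy) =
    ≼-unshift {c} {μ} {x} cx μ≼cx , ≼-unshift {c} {μ} {y} cy μ≼cy ,
    Between-cong (cancel⁻¹-∷ c x) ≈-refl (cancel⁻¹-∷ c y) (Between-translate [ invLetter c ] {c ∷ x} {μ} {c ∷ y} cxμcy)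

  -- A common descent of x and y is also a descent of their median, since otherwise
  -- it would shorten the geodesic from x to y through the median.
  Descent-median : ∀ {c x y ν} → Descent c x → Descent c y → IsMedian x y ν → Descent c ν
  Descent-median {c} {x} {y} {ν} cx cy (ν≼x , ν≼y , xνy) with Descent? c ν
  ... | yes cν = cν
  ... | no ¬cν = ⊥-elim (m+n≮n 1 (norm (c ∷ s) + norm (c ∷ t)) too-long)
    where
    s = inv ν ++ x
    t = inv ν ++ y
    νs≈x : ν ++ s ≈ x
    νs≈x = cancel-inverseʳ [] ν x
    νt≈y : ν ++ t ≈ y
    νt≈y = cancel-inverseʳ [] ν y
    cs : Descent c s
    cs = proj₁ (Descent-++ {c} {ν} {s} (trans (norm-cong νs≈x) (sym ν≼x)) (Descent-cong (≈-sym νs≈x) cx) ¬cν)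
    ct : Descent c t
    ct = proj₁ (Descent-++ {c} {ν} {t} (trans (norm-cong νt≈y) (sym ν≼y)) (Descent-cong (≈-sym νt≈y) cy) ¬cν)
    open ≤-Reasoning
    too-long : suc (suc (norm (c ∷ s) + norm (c ∷ t))) ≤ norm (c ∷ s) + norm (c ∷ t)
    too-long = begin
      suc (suc (norm (c ∷ s) + norm (c ∷ t))) ≡⟨ cong suc (+-suc (norm (c ∷ s)) (norm (c ∷ t))) ⟨
      suc (norm (c ∷ s)) + suc (norm (c ∷ t)) ≡⟨ cong₂ _+_ cs ct ⟩
      dist ν x + dist ν y                     ≡⟨ cong (_+ dist ν y) (dist-sym ν x) ⟩
      dist x ν + dist ν y                     ≡⟨ xνy ⟩
      dist x y                                ≡⟨ dist-cong (≈-sym νs≈x) (≈-sym νt≈y) ⟩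
      dist (ν ++ s) (ν ++ t)                  ≡⟨ dist-translate ν s t ⟩
      dist s t                                ≡⟨ dist-translate [ c ] s t ⟨
      dist (c ∷ s) (c ∷ t)                    ≤⟨ dist-triangle (c ∷ s) [] (c ∷ t) ⟩
      dist (c ∷ s) [] + norm (c ∷ t)          ≡⟨ cong (_+ norm (c ∷ t)) (dist-[]ʳ (c ∷ s)) ⟩
      norm (c ∷ s) + norm (c ∷ t)             ∎

  UniqueMedian : Word k → Word k → Word k → Set
  UniqueMedian x y μ = IsMedian x y μ × (∀ ν → IsMedian x y ν → ν ≈ μ)

  -- Cancel common descents until there are none left; then the median is 1.
  unique-median : ∀ n x y → norm x ≡ n → ∃[ μ ] UniqueMedian x y μ
  unique-median n x y eq with CommonDescent? x y
  unique-median zero x y eq | yes (c , cx , cy) = ⊥-elim (1+n≢0 (trans cx eq))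
  unique-median (suc n) x y eq | yes (c , cx , cy)
    with unique-median n (c ∷ x) (c ∷ y) (suc-injective (trans cx eq))
  ... | μ , isMedian , unique =
    invLetter c ∷ μ , IsMedian-unshift {c} {x} {y} {μ} cx cy isMedian , unique′
    where
    unique′ : ∀ ν → IsMedian x y ν → ν ≈ invLetter c ∷ μ
    unique′ ν isMedianν = ≈-trans (≈-sym (cancel⁻¹-∷ c ν)) (≈-∷ (invLetter c) (unique (c ∷ ν) shifted))
      where
      shifted : IsMedian (c ∷ x) (c ∷ y) (c ∷ ν)
      shifted = IsMedian-shift {c} {x} {y} {ν} (Descent-median {c} {x} {y} {ν} cx cy isMedianν) isMedianν
  unique-median n x y eq | no none =
    [] , (refl , refl , xy-through-1) , λ ν (ν≼x , ν≼y , _) → ¬CommonDescent⇒≼-both⇒≈[] {x} {y} {ν} none ν≼x ν≼y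
    where
    xy-through-1 : Between x [] y
    xy-through-1 = trans (cong (_+ norm y) (dist-[]ʳ x)) (sym (¬CommonDescent⇒dist≡norm+norm {x} {y} none))

  median : ∀ x y → ∃[ μ ] UniqueMedian x y μ
  median x y = unique-median (norm x) x y refl

  median-unique : ∀ {x y m m′} → IsMedian x y m → IsMedian x y m′ → m ≈ m′
  median-unique {x} {y} {m} {m′} p q = ≈-trans (unique m p) (≈-sym (unique m′ q))
    where unique = proj₂ (proj₂ (median x y))

  -- If c is a descent of x but not of y, it commutes with the part p of x shared with y.
  peel-descent : ∀ {c x y p} → Descent c x → ¬ Descent c y → p ≼ x → p ≼ y →
                 x ≈ invLetter c ∷ p ++ c ∷ inv p ++ x × Descent c (inv p ++ x)
  peel-descent {c} {x} {y} {p} cx ¬cy p≼x p≼y = x≈ , proj₁ split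
    where
    s = inv p ++ x
    ps≈x : p ++ s ≈ x
    ps≈x = cancel-inverseʳ [] p x
    split : Descent c s × Independent c (normalForm p)
    split = Descent-++ {c} {p} {s} (trans (norm-cong ps≈x) (sym p≼x)) (Descent-cong (≈-sym ps≈x) cx)
                       (λ cp → ¬cy (Descent-≼ {c} {p} cp p≼y))
    open ≈-Reasoning
    x≈ : x ≈ invLetter c ∷ p ++ c ∷ s
    x≈ = begin
      x                                ≈⟨ ps≈x ⟨
      p ++ s                           ≈⟨ ≈-++ˡ p (cancel⁻¹-∷ c s) ⟨
      p ++ invLetter c ∷ c ∷ s         ≡⟨ ++-assoc p [ invLetter c ] (c ∷ s) ⟨
      (p ++ [ invLetter c ]) ++ c ∷ s  ≈⟨ ≈-++ʳ (c ∷ s) (commute-normalForm (invLetter c) {p} (proj₂ split)) ⟨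
      invLetter c ∷ p ++ c ∷ s         ∎

  -- Otherwise c could be cancelled from both ends of the path x, x ∧ y, y, z ∧ y, z
  -- (medians with base 1), giving a path from x to z shorter than dist x z.
  Descent-between : ∀ {c x y z} → Descent c x → Descent c z → Between x y z → Descent c y
  Descent-between {c} {x} {y} {z} cx cz xyz with Descent? c y
  ... | yes cy = cy
  ... | no ¬cy = ⊥-elim (m+n≮n 1 (norm (c ∷ s) + ((norm t + norm t′) + norm (c ∷ u))) too-long)
    where
    p = proj₁ (median x y)
    q = proj₁ (median z y)
    p-median : IsMedian x y p
    p-median = proj₁ (proj₂ (median x y))
    q-median : IsMedian z y q
    q-median = proj₁ (proj₂ (median z y))
    s = inv p ++ x
    t = inv p ++ y
    u = inv q ++ z
    t′ = inv q ++ y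
    x-peeled : x ≈ invLetter c ∷ p ++ c ∷ s × Descent c s
    x-peeled = peel-descent {c} {x} {y} {p} cx ¬cy (proj₁ p-median) (proj₁ (proj₂ p-median))
    z-peeled : z ≈ invLetter c ∷ q ++ c ∷ u × Descent c u
    z-peeled = peel-descent {c} {z} {y} {q} cz ¬cy (proj₁ q-median) (proj₁ (proj₂ q-median))
    open ≤-Reasoning
    p-q-via-y : dist p q ≤ norm t + norm t′
    p-q-via-y = ≤-trans (dist-triangle p y q) (≤-reflexive (cong (norm t +_) (dist-sym y q)))
    direct : dist x z ≤ norm (c ∷ s) + ((norm t + norm t′) + norm (c ∷ u))
    direct = begin
      dist x z                                         ≡⟨ dist-cong (proj₁ x-peeled) (proj₁ z-peeled) ⟩
      dist (invLetter c ∷ p ++ c ∷ s) (invLetter c ∷ q ++ c ∷ u)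
        ≡⟨ dist-translate [ invLetter c ] (p ++ c ∷ s) (q ++ c ∷ u) ⟩
      dist (p ++ c ∷ s) (q ++ c ∷ u)                   ≤⟨ dist-triangle (p ++ c ∷ s) p (q ++ c ∷ u) ⟩
      dist (p ++ c ∷ s) p + dist p (q ++ c ∷ u)        ≤⟨ +-monoʳ-≤ (dist (p ++ c ∷ s) p) (dist-triangle p q (q ++ c ∷ u)) ⟩
      dist (p ++ c ∷ s) p + (dist p q + dist q (q ++ c ∷ u))
        ≤⟨ +-monoʳ-≤ (dist (p ++ c ∷ s) p) (+-monoˡ-≤ (dist q (q ++ c ∷ u)) p-q-via-y) ⟩
      dist (p ++ c ∷ s) p + ((norm t + norm t′) + dist q (q ++ c ∷ u))
        ≡⟨ cong₂ (λ m n → m + ((norm t + norm t′) + n)) (trans (dist-sym _ p) (dist-++ʳ p (c ∷ s))) (dist-++ʳ q (c ∷ u)) ⟩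
      norm (c ∷ s) + ((norm t + norm t′) + norm (c ∷ u)) ∎
    zqy : dist q z + dist q y ≡ dist y z
    zqy = trans (cong (_+ dist q y) (dist-sym q z)) (trans (proj₂ (proj₂ q-median)) (dist-sym z y))
    too-long : suc (suc (norm (c ∷ s) + ((norm t + norm t′) + norm (c ∷ u))))
               ≤ norm (c ∷ s) + ((norm t + norm t′) + norm (c ∷ u))
    too-long = begin
      suc (suc (norm (c ∷ s) + ((norm t + norm t′) + norm (c ∷ u))))
        ≡⟨ rearrange (norm (c ∷ s)) (norm t) (norm t′) (norm (c ∷ u)) ⟩
      (suc (norm (c ∷ s)) + norm t) + (suc (norm (c ∷ u)) + norm t′)
        ≡⟨ cong₂ (λ m n → (m + norm t) + (n + norm t′)) (proj₂ x-peeled) (proj₂ z-peeled) ⟩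
      (dist p x + dist p y) + (dist q z + dist q y)
        ≡⟨ cong₂ (λ m n → (m + dist p y) + n) (dist-sym p x) zqy ⟩
      (dist x p + dist p y) + dist y z                 ≡⟨ cong (_+ dist y z) (proj₂ (proj₂ p-median)) ⟩
      dist x y + dist y z                              ≡⟨ xyz ⟩
      dist x z                                         ≤⟨ direct ⟩
      norm (c ∷ s) + ((norm t + norm t′) + norm (c ∷ u)) ∎
      where
      rearrange : ∀ a b b′ e → suc (suc (a + ((b + b′) + e))) ≡ (suc a + b) + (suc e + b′)
      rearrange = solve 4 (λ a b b′ e → con 2 :+ (a :+ ((b :+ b′) :+ e)) := (con 1 :+ a :+ b) :+ (con 1 :+ e :+ b′)) refl
        where open +-*-Solver

  Between-untranslate : ∀ a {x y z} → Between (inv a ++ x) y (inv a ++ z) → Between x (a ++ y) z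
  Between-untranslate a {x} {y} {z} b =
    Between-cong (cancel-inverseʳ [] a x) ≈-refl (cancel-inverseʳ [] a z)
                 (Between-translate a {inv a ++ x} {y} {inv a ++ z} b)

  median₃ : ∀ a b c → ∃[ ν ] (Between a ν b × Between a ν c × Between b ν c)
  median₃ a b c with median (inv a ++ b) (inv a ++ c)
  ... | μ , (μ≼b , μ≼c , bμc) , _ =
    a ++ μ , Between-untranslate a {a} (from-1 μ≼b) , Between-untranslate a {a} (from-1 μ≼c) , Between-untranslate a bμc
    where
    from-1 : ∀ {y z} → Between [] y z → Between (inv a ++ a) y z
    from-1 = Between-cong (≈-sym (inverseˡ a)) ≈-refl ≈-refl

  median-greatest : ∀ {x y m w} → IsMedian x y m → w ≼ x → w ≼ y → w ≼ m
  median-greatest {x} {y} {m} {w} m-median w≼x w≼y =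
    ≼-cong {w} {w} {ν} {m} ≈-refl (median-unique {x} {y} {ν} {m} ν-median m-median) (proj₂ outer-x)
    where
    ν = proj₁ (median₃ w x y)
    outer-x : ν ≼ x × w ≼ ν
    outer-x = between-outer {[]} {w} {x} {ν} w≼x (proj₁ (proj₂ (median₃ w x y)))
    outer-y : ν ≼ y × w ≼ ν
    outer-y = between-outer {[]} {w} {y} {ν} w≼y (proj₁ (proj₂ (proj₂ (median₃ w x y))))
    ν-median : IsMedian x y ν
    ν-median = proj₁ outer-x , proj₁ outer-y , proj₂ (proj₂ (proj₂ (median₃ w x y)))

  median-≼-between : ∀ n {x y z m} → norm x ≡ n → Between x y z → IsMedian x z m → m ≼ y
  median-≼-between n {x} {y} {z} {m} eq xyz m-median with CommonDescent? x z
  median-≼-between zero    eq xyz m-median | yes (c , cx , cz) = ⊥-elim (1+n≢0 (trans cx eq))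
  median-≼-between (suc n) {x} {y} {z} {m} eq xyz m-median | yes (c , cx , cz) with median (c ∷ x) (c ∷ z)
  ... | μ , μ-median , _ =
    ≼-cong {invLetter c ∷ μ} (median-unique {x} {z} (IsMedian-unshift {c} {x} {z} {μ} cx cz μ-median) m-median) ≈-refl
      (≼-unshift {c} {μ} {y} (Descent-between {c} {x} {y} {z} cx cz xyz)
        (median-≼-between n {c ∷ x} {c ∷ y} {c ∷ z} (suc-injective (trans cx eq))
                          (Between-translate [ c ] {x} {y} {z} xyz) μ-median))
  median-≼-between n {x} {y} {z} {m} eq xyz (m≼x , m≼z , _) | no none =
    ≼-cong {[]} {m} (≈-sym (¬CommonDescent⇒≼-both⇒≈[] {x} {z} {m} none m≼x m≼z)) ≈-refl refl

  -- Convex sets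

  Below⇒≼ : ∀ {u v} → Below F u v → u ≼ v
  Below⇒≼ (a , b , c , Na , Nb , Nc , b≡a+c) =
    trans (cong₂ _+_ (sym (Norm⇒≡norm Na)) (sym (Norm⇒≡norm Nc))) (trans (sym b≡a+c) (Norm⇒≡norm Nb))

  ≼⇒Below : ∀ {u v} → u ≼ v → Below F u v
  ≼⇒Below {u} {v} u≼v = norm u , norm v , dist u v , Norm-norm u , Norm-norm v , Norm-norm (inv u ++ v) , sym u≼v

  IsMedian⇒IsMeet : ∀ {x y m} → IsMedian x y m → IsMeet F m x y
  IsMedian⇒IsMeet {x} {y} {m} m-median@(m≼x , m≼y , _) =
    ≼⇒Below m≼x , ≼⇒Below m≼y ,
    λ w w≤x w≤y → ≼⇒Below (median-greatest {x} {y} {m} {w} m-median (Below⇒≼ w≤x) (Below⇒≼ w≤y))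

  IsMeet⇒Between : ∀ {x y m} → IsMeet F m x y → Between x m y
  IsMeet⇒Between {x} {y} {m} (m≤x , m≤y , greatest) =
    Between-cong {x} {x} {μ} {m} {y} {y} ≈-refl (≈-sym m≈μ) ≈-refl (proj₂ (proj₂ μ-median))
    where
    μ = proj₁ (median x y)
    μ-median : IsMedian x y μ
    μ-median = proj₁ (proj₂ (median x y))
    m≈μ : m ≈ μ
    m≈μ = ≼-antisym (median-greatest {x} {y} {μ} {m} μ-median (Below⇒≼ m≤x) (Below⇒≼ m≤y))
                    (Below⇒≼ (greatest μ (≼⇒Below (proj₁ μ-median)) (≼⇒Below (proj₁ (proj₂ μ-median)))))

  IsJoin⇒Between : ∀ {x y j} → IsJoin F j x y → Between x j y
  IsJoin⇒Between {x} {y} {j} (x≤j , y≤j , least) = Between-cong {x} {x} {ν} {j} {y} {y} ≈-refl ν≈j ≈-refl xνy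
    where
    ν = proj₁ (median₃ x y j)
    xνy : Between x ν y
    xνy = proj₁ (proj₂ (median₃ x y j))
    x-outer : ν ≼ j × x ≼ ν
    x-outer = between-outer {[]} {x} {j} {ν} (Below⇒≼ x≤j) (proj₁ (proj₂ (proj₂ (median₃ x y j))))
    y-outer : ν ≼ j × y ≼ ν
    y-outer = between-outer {[]} {y} {j} {ν} (Below⇒≼ y≤j) (proj₂ (proj₂ (proj₂ (median₃ x y j))))
    ν≈j : ν ≈ j
    ν≈j = ≼-antisym (proj₁ x-outer) (Below⇒≼ (least ν (≼⇒Below (proj₂ x-outer)) (≼⇒Below (proj₂ y-outer))))

  Convex⇒Between-closed : ∀ {L} → Convex F L → ∀ {x y z} → Between x y z → L x → L z → L y
  Convex⇒Between-closed (_ , convex) {x} {y} {z} xyz Lx Lz =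
    convex x y z (dist x y) (dist y z) (dist x z) Lx Lz (Norm-norm _) (Norm-norm _) (Norm-norm _) xyz

  Convex⇒IntervalClosed : ∀ {L} → Convex F L → IntervalClosed F L
  Convex⇒IntervalClosed convex x y z x≤y y≤z =
    Convex⇒Between-closed convex {x} {y} {z} (≼-≼⇒Between {x} {y} {z} (Below⇒≼ x≤y) (Below⇒≼ y≤z))

  Convex⇒LatticeClosed : ∀ {L} → Convex F L → LatticeClosed F L
  Convex⇒LatticeClosed convex x y Lx Ly =
    (λ m m-meet → Convex⇒Between-closed convex (IsMeet⇒Between {x} {y} {m} m-meet) Lx Ly) ,
    (λ j j-join → Convex⇒Between-closed convex (IsJoin⇒Between {x} {y} {j} j-join) Lx Ly)

  dist-∷ʳ : ∀ x a → dist x (x ++ [ a ]) ≡ 1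
  dist-∷ʳ x a = norm-cong (cancel-inverseˡ [] x [ a ])

  dist-∷ʳ-left : ∀ x a w → dist (x ++ [ a ]) w ≡ norm (invLetter a ∷ inv x ++ w)
  dist-∷ʳ-left x a w = cong (λ v → norm (v ++ w)) (inv-∷ʳ x a)

  norm-∷ʳ : ∀ x a → norm (x ++ [ a ]) ≡ norm (invLetter a ∷ inv x)
  norm-∷ʳ x a = trans (sym (norm-inv (x ++ [ a ]))) (cong norm (inv-∷ʳ x a))

  -- If x·a ⋠ u, then Descent-between, applied after translating by x⁻¹ and by (x·a)⁻¹,
  -- makes m both closer to x than to x·a and closer to x·a than to x.
  ∷ʳ-least : ∀ {x a z m u} → norm (x ++ [ a ]) ≡ suc (norm x) → Between x (x ++ [ a ]) z →
             Between (x ++ [ a ]) m z → x ≼ u → m ≼ u → x ++ [ a ] ≼ u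
  ∷ʳ-least {x} {a} {z} {m} {u} ascent x-xa-z xa-m-z x≼u m≼u with Descent? (invLetter a) (inv x ++ u)
  ... | yes a⁻¹x⁻¹u = begin
    norm (x ++ [ a ]) + dist (x ++ [ a ]) u            ≡⟨ cong₂ _+_ ascent (dist-∷ʳ-left x a u) ⟩
    suc (norm x) + norm (invLetter a ∷ inv x ++ u)     ≡⟨ +-suc (norm x) _ ⟨
    norm x + suc (norm (invLetter a ∷ inv x ++ u))     ≡⟨ cong (norm x +_) a⁻¹x⁻¹u ⟩
    norm x + dist x u                                  ≡⟨ x≼u ⟩
    norm u                                             ∎
    where open ≡-Reasoning
  ... | no ¬a⁻¹x⁻¹u = ⊥-elim (m+n≮n 1 (dist (x ++ [ a ]) m) (≤-reflexive (trans (cong suc towards-x) towards-xa)))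
    where
    x⁻¹xa : inv x ++ x ++ [ a ] ≈ [ a ]
    x⁻¹xa = cancel-inverseˡ [] x [ a ]
    xa⁻¹≈ : ∀ w → a ∷ inv (x ++ [ a ]) ++ w ≈ inv x ++ w
    xa⁻¹≈ w = ≈-trans (≈-reflexive (cong (λ v → a ∷ v ++ w) (inv-∷ʳ x a))) (cancel-∷ a (inv x ++ w))
    a⁻¹-descent-z : Descent (invLetter a) (inv x ++ z)
    a⁻¹-descent-z = trans (cong suc (sym (dist-∷ʳ-left x a z)))
                          (trans (cong (_+ dist (x ++ [ a ]) z) (sym (dist-∷ʳ x a))) x-xa-z)
    a⁻¹-descent-a : Descent (invLetter a) (inv x ++ x ++ [ a ])
    a⁻¹-descent-a = Descent-cong {invLetter a} (≈-sym x⁻¹xa) (cong suc (norm-cong (cancel⁻¹-∷ a [])))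
    towards-x : suc (dist (x ++ [ a ]) m) ≡ dist x m
    towards-x = trans (cong suc (dist-∷ʳ-left x a m))
      (Descent-between {invLetter a} {inv x ++ x ++ [ a ]} {inv x ++ m} {inv x ++ z} a⁻¹-descent-a a⁻¹-descent-z
        (Between-translate (inv x) {x ++ [ a ]} {m} {z} xa-m-z))
    a-descent-1 : Descent a (inv (x ++ [ a ]) ++ [])
    a-descent-1 = trans (cong suc (trans (norm-cong (xa⁻¹≈ [])) (dist-[]ʳ x)))
                        (trans (sym ascent) (sym (dist-[]ʳ (x ++ [ a ]))))
    a-descent-u : Descent a (inv (x ++ [ a ]) ++ u)
    a-descent-u = trans (cong suc (norm-cong (xa⁻¹≈ u)))
                        (trans (sym (¬Descent⇒ascent {invLetter a} {inv x ++ u} ¬a⁻¹x⁻¹u)) (sym (dist-∷ʳ-left x a u)))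
    towards-xa : suc (dist x m) ≡ dist (x ++ [ a ]) m
    towards-xa = trans (cong suc (sym (norm-cong (xa⁻¹≈ m))))
      (Descent-between {a} {inv (x ++ [ a ]) ++ []} {inv (x ++ [ a ]) ++ m} {inv (x ++ [ a ]) ++ u} a-descent-1 a-descent-u
        (Between-translate (inv (x ++ [ a ])) {[]} {m} {u} m≼u))

  module _ {L : Word k → Set} (subset : IsSubset F L)
           (interval : IntervalClosed F L) (lattice : LatticeClosed F L) where

    meet-closed : ∀ {x y m} → L x → L y → IsMedian x y m → L m
    meet-closed {x} {y} {m} Lx Ly m-median = proj₁ (lattice x y Lx Ly) m (IsMedian⇒IsMeet {x} {y} {m} m-median)

    -- A step down lies above the meet x ∧ z; a step up is the join of x with (x·a) ∧ z.
    step-closed : ∀ x z a → Between x (x ++ [ a ]) z → L x → L z → L (x ++ [ a ])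
    step-closed x z a x-xa-z Lx Lz with descent⊎ascent (invLetter a) (inv x) | median x z
    ... | inj₁ descent | μ , μ-median , _ =
      interval μ (x ++ [ a ]) x (≼⇒Below μ≼xa) (≼⇒Below xa≼x) (meet-closed {x} {z} {μ} Lx Lz μ-median) Lx
      where
      μ≼xa : μ ≼ x ++ [ a ]
      μ≼xa = median-≼-between (norm x) {x} {x ++ [ a ]} {z} {μ} refl x-xa-z μ-median
      xa≼x : x ++ [ a ] ≼ x
      xa≼x = begin
        norm (x ++ [ a ]) + dist (x ++ [ a ]) x
          ≡⟨ cong₂ _+_ (norm-∷ʳ x a) (trans (dist-sym (x ++ [ a ]) x) (dist-∷ʳ x a)) ⟩
        norm (invLetter a ∷ inv x) + 1            ≡⟨ +-comm _ 1 ⟩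
        suc (norm (invLetter a ∷ inv x))          ≡⟨ descent ⟩
        norm (inv x)                              ≡⟨ norm-inv x ⟩
        norm x                                    ∎
        where open ≡-Reasoning
    ... | inj₂ ascent | μ , μ-median@(μ≼x , μ≼z , _) , _ =
      proj₂ (lattice x m Lx Lm) (x ++ [ a ]) (≼⇒Below x≼xa , ≼⇒Below (proj₁ m-median) , λ u x≤u m≤u →
        ≼⇒Below (∷ʳ-least {x} {a} {z} {m} {u} xa-ascent x-xa-z (proj₂ (proj₂ m-median)) (Below⇒≼ x≤u) (Below⇒≼ m≤u)))
      where
      m = proj₁ (median (x ++ [ a ]) z)
      m-median : IsMedian (x ++ [ a ]) z m
      m-median = proj₁ (proj₂ (median (x ++ [ a ]) z))
      xa-ascent : norm (x ++ [ a ]) ≡ suc (norm x)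
      xa-ascent = trans (norm-∷ʳ x a) (trans ascent (cong suc (norm-inv x)))
      x≼xa : x ≼ x ++ [ a ]
      x≼xa = trans (cong (norm x +_) (dist-∷ʳ x a)) (trans (+-comm (norm x) 1) (sym xa-ascent))
      μ≼m : μ ≼ m
      μ≼m = median-greatest {x ++ [ a ]} {z} {m} {μ} m-median (≼-trans {μ} {x} {x ++ [ a ]} μ≼x x≼xa) μ≼z
      Lm : L m
      Lm = interval μ m z (≼⇒Below μ≼m) (≼⇒Below (proj₁ (proj₂ m-median))) (meet-closed {x} {z} {μ} Lx Lz μ-median) Lz

    Between-closed : ∀ n {x y z} → dist x y ≡ n → Between x y z → L x → L z → L y
    Between-closed zero    {x} {y} xy≡0 xyz Lx Lz = subset x y (dist≡0⇒≈ xy≡0) Lx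
    Between-closed (suc n) {x} {y} {z} xy≡n xyz Lx Lz
      with descent-exists {inv x ++ y} (λ xy≡0 → 1+n≢0 (trans (sym xy≡n) xy≡0))
    ... | c , descent =
      Between-closed n {x ++ [ invLetter c ]} {y} {z} xay≡n (proj₂ inner)
                     (step-closed x z (invLetter c) (proj₁ inner) Lx Lz) Lz
      where
      xay≡n : dist (x ++ [ invLetter c ]) y ≡ n
      xay≡n = suc-injective (trans (cong suc (trans (dist-∷ʳ-left x (invLetter c) y)
                                                  (cong (λ b → norm (b ∷ inv x ++ y)) (invLetter-involutive c))))
                                   (trans descent xy≡n))
      inner : Between x (x ++ [ invLetter c ]) z × Between (x ++ [ invLetter c ]) y z
      inner = between-inner {x} {x ++ [ invLetter c ]} {y} {z}
                            (trans (cong₂ _+_ (dist-∷ʳ x (invLetter c)) xay≡n) (sym xy≡n)) xyz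

  IntervalClosed×LatticeClosed⇒Convex : ∀ {L} → IsSubset F L → Nonempty L →
                                        IntervalClosed F L × LatticeClosed F L → Convex F L
  IntervalClosed×LatticeClosed⇒Convex subset nonempty (interval , lattice) =
    nonempty , λ x y z a b c Lx Lz Nxy Nyz Nxz a+b≡c →
      Between-closed subset interval lattice (dist x y) refl
        (trans (cong₂ _+_ (sym (Norm⇒≡norm Nxy)) (sym (Norm⇒≡norm Nyz))) (trans a+b≡c (Norm⇒≡norm Nxz))) Lx Lz

proposition2 : (k : ℕ) (F : PairSet k) (L : Word k → Set) →
    IsSubset F L → Nonempty L →
    (Convex F L → IntervalClosed F L × LatticeClosed F L)
    × (IntervalClosed F L × LatticeClosed F L → Convex F L)
proposition2 k F L subset nonempty =
  (λ convex → Convex⇒IntervalClosed F convex , Convex⇒LatticeClosed F convex) ,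
  IntervalClosed×LatticeClosed⇒Convex F subset nonempty
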